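{- Let $\overrightarrow{H}$ be an absolute oriented clique on $n$ vertices, let $x$ be a vertex of $\overrightarrow{H}$, and let $\overrightarrow{H}'$ be the oriented graph obtained from $\overrightarrow{H}$ by pushing $x$. Then $n-1 \leq \chi_o(\overrightarrow{H}') \leq n$.
   Context: An oriented graph is a finite directed graph with no loops, no multiple arcs and no directed cycle of length $2$. A homomorphism of an oriented graph $\overrightarrow{G}$ to an oriented graph $\overrightarrow{T}$ is a map $\phi:V(\overrightarrow{G})\to V(\overrightarrow{T})$ such that for every arc $uv$ of $\overrightarrow{G}$, $\phi(u)\phi(v)$ is an arc of $\overrightarrow{T}$. The oriented chromatic number $\chi_o(\overrightarrow{G})$ is the minimum $|V(\overrightarrow{T})|$ over oriented graphs $\overrightarrow{T}$ admitting a homomorphism from $\overrightarrow{G}$. An absolute oriented clique is an oriented graph $\overrightarrow{C}$ with $\chi_o(\overrightarrow{C}) = |V(\overrightarrow{C})|$. To push a vertex $x$ means to reverse the orientation of every arc incident to $x$ (so in-neighbors of $x$ become out-neighbors and vice versa), leaving all other arcs unchanged. -}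

module Defs where

open import Data.Nat using (ℕ; _≤_)
open import Data.Fin using (Fin)
open import Data.Fin.Properties using (_≟_)
open import Data.Bool using (Bool; true; false; not; _xor_; if_then_else_)
open import Data.Product using (Σ; _×_; ∃-syntax)
open import Relation.Binary.PropositionalEquality using (_≡_; _≢_)
import Relation.Binary.PropositionalEquality
open import Relation.Nullary.Decidable using (⌊_⌋)

-- Multiple arcs are impossible by
-- construction.
record OrientedGraph (n : ℕ) : Set where
  field
    arc        : Fin n → Fin n → Bool
    loopless   : ∀ u → arc u u ≡ false
    no2cycle   : ∀ u v → arc u v ≡ true → arc v u ≡ false
open OrientedGraph public

IsHom : ∀ {n m} → OrientedGraph n → OrientedGraph m → (Fin n → Fin m) → Set
IsHom G T φ = ∀ u v → arc G u v ≡ true → arc T (φ u) (φ v) ≡ true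

ColourableWith : ∀ {n} → OrientedGraph n → ℕ → Set
ColourableWith G m = Σ (OrientedGraph m) λ T → Σ (Fin _ → Fin m) λ φ → IsHom G T φ

OrientedChromaticNumber : ∀ {n} → OrientedGraph n → ℕ → Set
OrientedChromaticNumber G k =
  ColourableWith G k × (∀ m → ColourableWith G m → k ≤ m)

AbsoluteOrientedClique : ∀ {n} → OrientedGraph n → Set
AbsoluteOrientedClique {n} G = OrientedChromaticNumber G n

-- Pushing x: reverse every arc incident to x.
pushArc : ∀ {n} → OrientedGraph n → Fin n → Fin n → Fin n → Bool
pushArc G x u v =
  if ⌊ u ≟ x ⌋ xor ⌊ v ≟ x ⌋ then arc G v u else arc G u v

private
  xor-sym : ∀ a b → a xor b ≡ b xor a
  xor-sym false false = Relation.Binary.PropositionalEquality.refl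
  xor-sym false true  = Relation.Binary.PropositionalEquality.refl
  xor-sym true  false = Relation.Binary.PropositionalEquality.refl
  xor-sym true  true  = Relation.Binary.PropositionalEquality.refl

  aa : ∀ a → a xor a ≡ false
  aa false = Relation.Binary.PropositionalEquality.refl
  aa true  = Relation.Binary.PropositionalEquality.refl

push : ∀ {n} → OrientedGraph n → Fin n → OrientedGraph n
push {n} G x = record
  { arc = pushArc G x
  ; loopless = lp
  ; no2cycle = nc
  }
  where
  open Relation.Binary.PropositionalEquality
  lp : ∀ u → pushArc G x u u ≡ false
  lp u rewrite aa ⌊ u ≟ x ⌋ = loopless G u
  nc : ∀ u v → pushArc G x u v ≡ true → pushArc G x v u ≡ false
  nc u v e with ⌊ u ≟ x ⌋ xor ⌊ v ≟ x ⌋ in eq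
  ... | true  rewrite xor-sym ⌊ v ≟ x ⌋ ⌊ u ≟ x ⌋ | eq = no2cycle G v u e
  ... | false rewrite xor-sym ⌊ v ≟ x ⌋ ⌊ u ≟ x ⌋ | eq = no2cycle G u v e

-- A homomorphism of the pushed graph to T becomes a homomorphism of H to T
-- plus one fresh vertex: colour x by the fresh vertex and give it the arcs
-- of φ(x) reversed.  As H is an absolute clique this forces
-- χ_o(push H x) ≥ n − 1, while the identity gives χ_o(push H x) ≤ n.
-- Which of the two values occurs is decided by brute force over all
-- (n − 1)-colourings, which makes the chromatic number exist constructively.
module Submission where

open import Defs
open import Data.Nat using (ℕ; zero; suc; _≤_; _∸_; s≤s⁻¹)
open import Data.Nat.Properties using (≤-refl; n≤1+n; ≤∧≢⇒<)
open import Data.Fin as Fin using (Fin)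
import Data.Fin.Properties as Finₚ
import Data.Bool.Properties as Boolₚ
open import Data.Bool using (Bool; true; false)
open import Data.Vec.Functional using (_∷_; head; tail)
open import Data.Product using (Σ; ∃; _×_; _,_; proj₂)
open import Data.Empty using (⊥-elim)
open import Relation.Nullary using (Dec; yes; no; does)
open import Relation.Nullary.Decidable using (map′; _×-dec_; _→-dec_; ¬?; dec-true; dec-yes; dec-no)
open import Relation.Binary.PropositionalEquality

any-function? : ∀ {n m} {P : (Fin n → Fin m) → Set} →
                (∀ {f g} → (∀ i → f i ≡ g i) → P f → P g) →
                (∀ f → Dec (P f)) → Dec (∃ P)
any-function? {zero} {m} resp P? =
  map′ (λ p → empty , p) (λ (f , p) → resp {f} (λ ()) p) (P? empty)
  where
  empty : Fin zero → Fin m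
  empty ()
any-function? {suc n} {P = P} resp P? =
  map′ (λ (a , g , p) → a ∷ g , p)
       (λ (f , p) → head f , tail f , resp (λ { Fin.zero → refl ; (Fin.suc i) → refl }) p)
       (Finₚ.any? λ a →
          any-function? (λ e → resp (λ { Fin.zero → refl ; (Fin.suc i) → e i }))
                        (λ g → P? (a ∷ g)))

-- Exactly the conditions under which the image of φ has no loop and no 2-cycle.
IsOrientedColouring : ∀ {n m} → OrientedGraph n → (Fin n → Fin m) → Set
IsOrientedColouring G φ =
  (∀ u v → arc G u v ≡ true → φ u ≢ φ v) ×
  (∀ u v u′ v′ → arc G u v ≡ true → arc G u′ v′ ≡ true → φ u ≡ φ v′ → φ v ≢ φ u′)

isOrientedColouring? : ∀ {n m} (G : OrientedGraph n) (φ : Fin n → Fin m) →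
                       Dec (IsOrientedColouring G φ)
isOrientedColouring? G φ =
  Finₚ.all? (λ u → Finₚ.all? λ v →
    (arc G u v Boolₚ.≟ true) →-dec ¬? (φ u Finₚ.≟ φ v))
  ×-dec
  Finₚ.all? (λ u → Finₚ.all? λ v → Finₚ.all? λ u′ → Finₚ.all? λ v′ →
    (arc G u v Boolₚ.≟ true) →-dec (arc G u′ v′ Boolₚ.≟ true) →-dec
    (φ u Finₚ.≟ φ v′) →-dec ¬? (φ v Finₚ.≟ φ u′))

isOrientedColouring-resp : ∀ {n m} (G : OrientedGraph n) {φ ψ : Fin n → Fin m} →
                           (∀ i → φ i ≡ ψ i) →
                           IsOrientedColouring G φ → IsOrientedColouring G ψ
isOrientedColouring-resp G e (proper , noOpposite) =
  (λ u v a q → proper u v a (trans (e u) (trans q (sym (e v))))) ,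
  (λ u v u′ v′ a a′ q r →
     noOpposite u v u′ v′ a a′ (trans (e u) (trans q (sym (e v′))))
                               (trans (e v) (trans r (sym (e u′)))))

hom⇒isOrientedColouring : ∀ {n m} (G : OrientedGraph n) (T : OrientedGraph m) {φ : Fin n → Fin m} →
                          IsHom G T φ → IsOrientedColouring G φ
hom⇒isOrientedColouring G T {φ} hom =
  (λ u v a q → notLoop (hom u v a) q) ,
  (λ u v u′ v′ a a′ q r → notOpposite (hom u v a) (hom u′ v′ a′) q r)
  where
  notLoop : ∀ {s t} → arc T s t ≡ true → s ≢ t
  notLoop {s} a refl with () ← trans (sym a) (loopless T s)
  notOpposite : ∀ {s t s′ t′} → arc T s t ≡ true → arc T s′ t′ ≡ true → s ≡ t′ → t ≢ s′
  notOpposite {s} {t} a a′ refl refl with () ← trans (sym a′) (no2cycle T s t a)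

isOrientedColouring⇒colourable : ∀ {n m} (G : OrientedGraph n) (φ : Fin n → Fin m) →
                                  IsOrientedColouring G φ → ColourableWith G m
isOrientedColouring⇒colourable {m = m} G φ (proper , noOpposite) = image , φ , hom
  where
  ImageArc : Fin m → Fin m → Set
  ImageArc s t = ∃ λ u → ∃ λ v → arc G u v ≡ true × φ u ≡ s × φ v ≡ t
  imageArc? : ∀ s t → Dec (ImageArc s t)
  imageArc? s t = Finₚ.any? λ u → Finₚ.any? λ v →
    (arc G u v Boolₚ.≟ true) ×-dec (φ u Finₚ.≟ s) ×-dec (φ v Finₚ.≟ t)
  loopless′ : ∀ s → does (imageArc? s s) ≡ false
  loopless′ s with imageArc? s s
  ... | yes (u , v , a , refl , q) = ⊥-elim (proper u v a (sym q))
  ... | no _ = refl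
  no2cycle′ : ∀ s t → does (imageArc? s t) ≡ true → does (imageArc? t s) ≡ false
  no2cycle′ s t st with imageArc? s t | imageArc? t s
  ... | yes (u , v , a , p , q) | yes (u′ , v′ , a′ , p′ , q′) =
        ⊥-elim (noOpposite u v u′ v′ a a′ (trans p (sym q′)) (trans q (sym p′)))
  ... | _ | no _ = refl
  image : OrientedGraph m
  image = record { arc = λ s t → does (imageArc? s t) ; loopless = loopless′ ; no2cycle = no2cycle′ }
  hom : IsHom G image φ
  hom u v a = dec-true (imageArc? (φ u) (φ v)) (u , v , a , refl , refl)

colourableWith? : ∀ {n} m (G : OrientedGraph n) → Dec (ColourableWith G m)
colourableWith? m G =
  map′ (λ (φ , c) → isOrientedColouring⇒colourable G φ c)
       (λ (T , φ , hom) → φ , hom⇒isOrientedColouring G T hom)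
       (any-function? (isOrientedColouring-resp G) (isOrientedColouring? G))

chromaticNumber-between : ∀ {n} (G : OrientedGraph n) p →
                          ColourableWith G (suc p) → (∀ m → ColourableWith G m → p ≤ m) →
                          Σ ℕ λ k → OrientedChromaticNumber G k × (p ≤ k × k ≤ suc p)
chromaticNumber-between G p colourable lower with colourableWith? p G
... | yes c = p , (c , lower) , ≤-refl , n≤1+n p
... | no ¬c = suc p , (colourable , lower′) , n≤1+n p , ≤-refl
  where
  lower′ : ∀ m → ColourableWith G m → suc p ≤ m
  lower′ m c = ≤∧≢⇒< (lower m c) λ { refl → ¬c c }

push-arc-away : ∀ {n} (G : OrientedGraph n) {x u v} → u ≢ x → v ≢ x →
                arc (push G x) u v ≡ arc G u v
push-arc-away G {x} {u} {v} u≢x v≢x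
  rewrite dec-no (u Finₚ.≟ x) u≢x | dec-no (v Finₚ.≟ x) v≢x = refl

push-arc-from : ∀ {n} (G : OrientedGraph n) {x v} → v ≢ x →
                arc (push G x) v x ≡ arc G x v
push-arc-from G {x} {v} v≢x
  rewrite dec-no (v Finₚ.≟ x) v≢x | proj₂ (dec-yes (x Finₚ.≟ x) refl) = refl

push-arc-to : ∀ {n} (G : OrientedGraph n) {x u} → u ≢ x →
              arc (push G x) x u ≡ arc G u x
push-arc-to G {x} {u} u≢x
  rewrite proj₂ (dec-yes (x Finₚ.≟ x) refl) | dec-no (u Finₚ.≟ x) u≢x = refl

unpush-colourable : ∀ {n m} (G : OrientedGraph n) x →
                    ColourableWith (push G x) m → ColourableWith G (suc m)
unpush-colourable {n} {m} G x (T , φ , hom) = T⁺ , ψ , hom⁺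
  where
  arc⁺ : Fin (suc m) → Fin (suc m) → Bool
  arc⁺ Fin.zero    Fin.zero    = false
  arc⁺ Fin.zero    (Fin.suc t) = arc T t (φ x)
  arc⁺ (Fin.suc s) Fin.zero    = arc T (φ x) s
  arc⁺ (Fin.suc s) (Fin.suc t) = arc T s t
  loopless⁺ : ∀ s → arc⁺ s s ≡ false
  loopless⁺ Fin.zero    = refl
  loopless⁺ (Fin.suc s) = loopless T s
  no2cycle⁺ : ∀ s t → arc⁺ s t ≡ true → arc⁺ t s ≡ false
  no2cycle⁺ Fin.zero    (Fin.suc t) = no2cycle T t (φ x)
  no2cycle⁺ (Fin.suc s) Fin.zero    = no2cycle T (φ x) s
  no2cycle⁺ (Fin.suc s) (Fin.suc t) = no2cycle T s t
  T⁺ : OrientedGraph (suc m)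
  T⁺ = record { arc = arc⁺ ; loopless = loopless⁺ ; no2cycle = no2cycle⁺ }
  ψ : Fin n → Fin (suc m)
  ψ u with u Finₚ.≟ x
  ... | yes _ = Fin.zero
  ... | no _  = Fin.suc (φ u)
  hom⁺ : IsHom G T⁺ ψ
  hom⁺ u v a with u Finₚ.≟ x | v Finₚ.≟ x
  ... | yes refl | yes refl with () ← trans (sym a) (loopless G u)
  ... | yes refl | no v≢x  = hom v u (trans (push-arc-from G v≢x) a)
  ... | no u≢x   | yes refl = hom v u (trans (push-arc-to G u≢x) a)
  ... | no u≢x   | no v≢x  = hom u v (trans (push-arc-away G u≢x v≢x) a)

push-chromaticNumber-lower : ∀ {n k m} (G : OrientedGraph n) x →
                             OrientedChromaticNumber G k →
                             ColourableWith (push G x) m → k ≤ suc m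
push-chromaticNumber-lower G x (_ , minimal) c = minimal _ (unpush-colourable G x c)

lemma2 : (n : ℕ) (H : OrientedGraph n) → AbsoluteOrientedClique H →
         (x : Fin n) →
         Σ ℕ λ k → OrientedChromaticNumber (push H x) k × (n ∸ 1 ≤ k × k ≤ n)
lemma2 zero    H clique ()
lemma2 (suc p) H clique x =
  chromaticNumber-between (push H x) p (push H x , (λ u → u) , λ _ _ a → a)
    λ m c → s≤s⁻¹ (push-chromaticNumber-lower H x clique c)
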